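{- Let $k\geq 1$, $n=8k+8$, $G=C(n,\pm\{1,2,3,4\})$, and let $m,m'\in\{1,\dots,k\}$ with $m<m'$. Let $A_0=\{4k+4,4k+5,4k+6\}$, $A_i=\{4k+4+4i,4k+5+4i\}$ for $1\leq i\leq k$, $B_1=\{8k+7,1\}$, $B_2=\{4m+2,4m+4\}$, $B_3=\{4m'+1,4m'+3\}$, and suppose $A=(A_0,A_1,\dots,A_k,B_1,B_2,B_3)$ is an $S$-cluster for some $S\subseteq V(G)$. If $X\subseteq V(G)\setminus\{0,1,\dots,4m'+1\}$ resolves $A$, then $|X|\geq 3$.
   Context: $C(n,\pm\{1,2,3,4\})$ is the graph on $\mathbb{Z}_n=\{0,\dots,n-1\}$ where distinct $i,j$ are adjacent iff $j-i\equiv\pm s\pmod n$ for some $s\in\{1,2,3,4\}$; $d$ is graph distance, and $r(v|X)=(d(v,x))_{x\in X}$. For $S\subseteq V$, a set $B$ is an $S$-block if $r(a|S)=r(b|S)$ for all $a,b\in B$. A tuple $(A_1,\dots,A_p)$ of $S$-blocks is an $S$-cluster if the $A_i$ are contained in distinct equivalence classes of $u\sim_S v\iff r(u|S)=r(v|S)$. A set $X$ resolves a tuple $(A_1,\dots,A_p)$ if $r(a|X)\neq r(b|X)$ for all distinct $a,b$ in the same $A_j$. -}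

module Defs where

open import Data.Product using (_×_)
open import Data.Bool using (Bool; true; false; _∨_; _∧_; if_then_else_)
open import Data.Nat using (ℕ; zero; suc; _+_; _*_; _<_; _≤_; _≡ᵇ_; NonZero)
open import Data.Nat.DivMod using (_%_; _mod_)
open import Data.Fin using (Fin; toℕ)
open import Data.Fin.Subset using (Subset) renaming (_∈_ to _∈ₛ_)
open import Data.List using (List; []; _∷_; _++_; applyUpTo; allFin; length; lookup)
open import Data.Bool.ListAction using (any)
open import Data.List.Membership.Propositional using (_∈_)
open import Relation.Binary.PropositionalEquality using (_≡_; _≢_)
open import Relation.Nullary using (¬_)

diffIs : (n : ℕ) .{{_ : NonZero n}} → Fin n → Fin n → ℕ → Bool
diffIs n i j s = toℕ j ≡ᵇ ((toℕ i + s) % n)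

adj : (n : ℕ) .{{_ : NonZero n}} → Fin n → Fin n → Bool
adj n i j =
  if toℕ i ≡ᵇ toℕ j then false
  else (diffIs n i j 1 ∨ diffIs n i j 2 ∨ diffIs n i j 3 ∨ diffIs n i j 4
        ∨ diffIs n j i 1 ∨ diffIs n j i 2 ∨ diffIs n j i 3 ∨ diffIs n j i 4)

ball : (n : ℕ) .{{_ : NonZero n}} → ℕ → Fin n → Fin n → Bool
ball n zero    u v = toℕ u ≡ᵇ toℕ v
ball n (suc t) u v = ball n t u v ∨ any (λ w → ball n t u w ∧ adj n w v) (allFin n)

-- least t in [from, from + fuel) with p t, or from + fuel if none
firstFrom : ℕ → ℕ → (ℕ → Bool) → ℕ
firstFrom from zero       p = from
firstFrom from (suc fuel) p = if p from then from else firstFrom (suc from) fuel p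

-- graph distance d(u,v): least t such that v is reachable from u by a walk of
-- length ≤ t (searching t < n suffices since any shortest path has < n edges)
dist : (n : ℕ) .{{_ : NonZero n}} → Fin n → Fin n → ℕ
dist n u v = firstFrom 0 n (λ t → ball n t u v)

sameRep : (n : ℕ) .{{_ : NonZero n}} → Subset n → Fin n → Fin n → Set
sameRep n X a b = ∀ x → x ∈ₛ X → dist n a x ≡ dist n b x

IsBlock : (n : ℕ) .{{_ : NonZero n}} → Subset n → List (Fin n) → Set
IsBlock n S B = ∀ a b → a ∈ B → b ∈ B → sameRep n S a b

IsCluster : (n : ℕ) .{{_ : NonZero n}} → Subset n → List (List (Fin n)) → Set
IsCluster n S As =
  ((i : Fin (length As)) → IsBlock n S (lookup As i)) ×
  ((i j : Fin (length As)) → i ≢ j → ∀ a b →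
     a ∈ lookup As i → b ∈ lookup As j → ¬ sameRep n S a b)

Resolves : (n : ℕ) .{{_ : NonZero n}} → Subset n → List (List (Fin n)) → Set
Resolves n X As = (j : Fin (length As)) → ∀ a b →
  a ∈ lookup As j → b ∈ lookup As j → a ≢ b → ¬ sameRep n X a b

-- the order n = 8k+8, written suc (8k+7) so that NonZero is found
ord : ℕ → ℕ
ord k = suc (8 * k + 7)

-- vertex with label v (all labels used below are < n)
vx : (k v : ℕ) → Fin (ord k)
vx k v = v mod ord k

clusterA : (k m m' : ℕ) → List (List (Fin (ord k)))
clusterA k m m' =
  (vx k (4 * k + 4) ∷ vx k (4 * k + 5) ∷ vx k (4 * k + 6) ∷ []) ∷
  (applyUpTo (λ j → let i = suc j in
      vx k (4 * k + 4 + 4 * i) ∷ vx k (4 * k + 5 + 4 * i) ∷ []) k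
  ++ ((vx k (8 * k + 7) ∷ vx k 1 ∷ []) ∷
      (vx k (4 * m + 2) ∷ vx k (4 * m + 4) ∷ []) ∷
      (vx k (4 * m' + 1) ∷ vx k (4 * m' + 3) ∷ []) ∷ []))

-- In C(n, ±{1,2,3,4}) two vertices joined by arcs of lengths f and n - f are at distance
-- ⌈f/4⌉ ⊓ ⌈(n - f)/4⌉.  Six pairs {a, a + s} (s ∈ {1, 2}) lie inside blocks of A.  A
-- vertex x is equidistant from a and a + s whenever neither arc from x to the pair
-- crosses a multiple of 4, which depends only on x - a mod 4; close to A₀ one short arc
-- suffices.  Hence every admissible x is equidistant from the pairs of one of eight
-- triples, determined by x mod 4 and the position of x relative to A₀, and any two of
-- these triples meet: two vertices never resolve A.
module Submission where

open import Defs
open import Data.Nat using (ℕ; _+_; _*_; _<_; _≤_)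
open import Data.Fin using (toℕ)
open import Data.Fin.Subset using (Subset; ∣_∣) renaming (_∈_ to _∈ₛ_)
open import Data.Bool using (Bool; true; false; T; _∨_; _∧_)
open import Data.Bool.Properties using (T-∨; T-∧)
open import Data.Nat
open import Data.Nat.Properties
open import Data.Nat.DivMod
open import Data.Nat.Tactic.RingSolver using (solve-∀; solve)
open import Data.Fin using (Fin; zero; suc)
open import Data.Fin.Properties using (toℕ<n; toℕ-fromℕ<; toℕ-injective)
open import Data.Fin.Subset using (inside; outside)
open import Data.List as List using (List; _∷_; []; allFin; length; lookup)
open import Data.List.Properties using (length-map)
open import Data.List.Membership.Propositional using (_∈_; lose; find)
open import Data.List.Membership.Propositional.Properties
  using (∈-allFin; ∈-++⁺ˡ; ∈-++⁺ʳ; ∈-applyUpTo⁺; ∈-map⁺)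
open import Data.List.Relation.Unary.All as All using (All)
open import Data.List.Relation.Unary.All.Properties as All using ()
open import Data.List.Relation.Unary.Any using (Any; here; there; any?; index)
open import Data.List.Relation.Unary.Any.Properties using (any⁺; any⁻; lookup-index)
open import Data.Product using (∃-syntax; _×_; _,_; proj₁; proj₂)
open import Data.Sum using (_⊎_; inj₁; inj₂; [_,_]′)
open import Function using (_∘_; Equivalence)
open import Relation.Binary.Definitions using (DecidableEquality; tri<; tri≈; tri>)
open import Relation.Binary.PropositionalEquality
open import Relation.Nullary using (¬_; yes; no; contradiction)
open import Relation.Nullary.Decidable using (map′; from-yes)

⌈_/4⌉ : ℕ → ℕ
⌈ 0 /4⌉ = 0
⌈ 1 /4⌉ = 1
⌈ 2 /4⌉ = 1
⌈ 3 /4⌉ = 1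
⌈ suc (suc (suc (suc n))) /4⌉ = suc ⌈ n /4⌉

n≤⌈n/4⌉*4 : ∀ n → n ≤ ⌈ n /4⌉ * 4
n≤⌈n/4⌉*4 0 = z≤n
n≤⌈n/4⌉*4 1 = s≤s z≤n
n≤⌈n/4⌉*4 2 = s≤s (s≤s z≤n)
n≤⌈n/4⌉*4 3 = s≤s (s≤s (s≤s z≤n))
n≤⌈n/4⌉*4 (suc (suc (suc (suc n)))) = s≤s (s≤s (s≤s (s≤s (n≤⌈n/4⌉*4 n))))

n≤t*4⇒⌈n/4⌉≤t : ∀ n {t} → n ≤ t * 4 → ⌈ n /4⌉ ≤ t
n≤t*4⇒⌈n/4⌉≤t 0 _ = z≤n
n≤t*4⇒⌈n/4⌉≤t 1 {suc t} _ = s≤s z≤n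
n≤t*4⇒⌈n/4⌉≤t 2 {suc t} _ = s≤s z≤n
n≤t*4⇒⌈n/4⌉≤t 3 {suc t} _ = s≤s z≤n
n≤t*4⇒⌈n/4⌉≤t (suc (suc (suc (suc n)))) {suc t} (s≤s (s≤s (s≤s (s≤s n≤)))) =
  s≤s (n≤t*4⇒⌈n/4⌉≤t n n≤)

⌈n/4⌉≤n : ∀ n → ⌈ n /4⌉ ≤ n
⌈n/4⌉≤n n = n≤t*4⇒⌈n/4⌉≤t n (m≤m*n n 4)

⌈/4⌉-mono-≤ : ∀ {m n} → m ≤ n → ⌈ m /4⌉ ≤ ⌈ n /4⌉
⌈/4⌉-mono-≤ {m} {n} m≤n = n≤t*4⇒⌈n/4⌉≤t m (≤-trans m≤n (n≤⌈n/4⌉*4 n))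

⌈t*4+n/4⌉≡t+⌈n/4⌉ : ∀ t n → ⌈ t * 4 + n /4⌉ ≡ t + ⌈ n /4⌉
⌈t*4+n/4⌉≡t+⌈n/4⌉ zero    n = refl
⌈t*4+n/4⌉≡t+⌈n/4⌉ (suc t) n = cong suc (⌈t*4+n/4⌉≡t+⌈n/4⌉ t n)

⌈/4⌉-shift : ∀ t {ρ s} → ⌈ ρ + s /4⌉ ≡ ⌈ ρ /4⌉ → ⌈ t * 4 + ρ + s /4⌉ ≡ ⌈ t * 4 + ρ /4⌉
⌈/4⌉-shift t {ρ} {s} same-block = begin
  ⌈ t * 4 + ρ + s /4⌉   ≡⟨ cong ⌈_/4⌉ (+-assoc (t * 4) ρ s) ⟩
  ⌈ t * 4 + (ρ + s) /4⌉ ≡⟨ ⌈t*4+n/4⌉≡t+⌈n/4⌉ t (ρ + s) ⟩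
  t + ⌈ ρ + s /4⌉       ≡⟨ cong (t +_) same-block ⟩
  t + ⌈ ρ /4⌉           ≡⟨ ⌈t*4+n/4⌉≡t+⌈n/4⌉ t ρ ⟨
  ⌈ t * 4 + ρ /4⌉       ∎
  where open ≡-Reasoning

firstFrom-least : ∀ fuel from c {p : ℕ → Bool} → T (p c) → (∀ t → T (p t) → c ≤ t) →
                  from ≤ c → c < from + fuel → firstFrom from fuel p ≡ c
firstFrom-least zero from c _ _ from≤c c<from+0 =
  contradiction (≤-trans c<from+0 (≤-reflexive (+-identityʳ from))) (≤⇒≯ from≤c)
firstFrom-least (suc fuel) from c {p} pc least from≤c c<end with p from in eq
... | true  = ≤-antisym from≤c (least from (subst T (sym eq) _))
... | false = firstFrom-least fuel (suc from) c pc least (≤∧≢⇒< from≤c from≢c)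
                (subst (c <_) (+-suc from fuel) c<end)
  where
  from≢c : from ≢ c
  from≢c refl = subst T eq pc

T-∨-elim : ∀ {x y} {C : Set} → (T x → C) → (T y → C) → T (x ∨ y) → C
T-∨-elim f g = [ f , g ]′ ∘ Equivalence.to T-∨

T-∨-introˡ : ∀ x {y} → T x → T (x ∨ y)
T-∨-introˡ _ = Equivalence.from T-∨ ∘ inj₁

T-∨-introʳ : ∀ x {y} → T y → T (x ∨ y)
T-∨-introʳ _ = Equivalence.from T-∨ ∘ inj₂

module Cyclic (N : ℕ) .{{_ : NonZero N}} where

  -- A record rather than a synonym, so that a, f and x are recovered by unification.
  record Steps (a f x : ℕ) : Set where
    constructor steps
    field
      reach : (a + f) % N ≡ x % N

  Apart : ℕ → ℕ → ℕ → Set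
  Apart f a b = Steps a f b ⊎ Steps b f a

  %-absorbˡ : ∀ a f → (a % N + f) % N ≡ (a + f) % N
  %-absorbˡ a f = begin
    (a % N + f) % N          ≡⟨ %-distribˡ-+ (a % N) f N ⟩
    (a % N % N + f % N) % N  ≡⟨ cong (λ r → (r + f % N) % N) (m%n%n≡m%n a N) ⟩
    (a % N + f % N) % N      ≡⟨ %-distribˡ-+ a f N ⟨
    (a + f) % N              ∎
    where open ≡-Reasoning

  +-cancelʳ-% : ∀ a b f → (a + f) % N ≡ (b + f) % N → a % N ≡ b % N
  +-cancelʳ-% a b f eq = trans (undo a) (trans (cong (λ r → (r + c) % N) eq) (sym (undo b)))
    where
    c = N ∸ f % N
    f+c≡ : f + c ≡ suc (f / N) * N
    f+c≡ = begin
      f + c                    ≡⟨ cong (_+ c) (m≡m%n+[m/n]*n f N) ⟩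
      f % N + f / N * N + c    ≡⟨ cong (_+ c) (+-comm (f % N) (f / N * N)) ⟩
      f / N * N + f % N + c    ≡⟨ +-assoc (f / N * N) (f % N) c ⟩
      f / N * N + (f % N + c)  ≡⟨ cong (f / N * N +_) (m+[n∸m]≡n (m%n≤n f N)) ⟩
      f / N * N + N            ≡⟨ +-comm (f / N * N) N ⟩
      suc (f / N) * N          ∎
      where open ≡-Reasoning
    undo : ∀ a → a % N ≡ ((a + f) % N + c) % N
    undo a = begin
      a % N                      ≡⟨ [m+kn]%n≡m%n a (suc (f / N)) N ⟨
      (a + suc (f / N) * N) % N  ≡⟨ cong (λ r → (a + r) % N) f+c≡ ⟨
      (a + (f + c)) % N          ≡⟨ cong (_% N) (+-assoc a f c) ⟨
      (a + f + c) % N            ≡⟨ %-absorbˡ (a + f) c ⟨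
      ((a + f) % N + c) % N      ∎
      where open ≡-Reasoning

  +-cancelˡ-% : ∀ a f g → (a + f) % N ≡ (a + g) % N → f % N ≡ g % N
  +-cancelˡ-% a f g eq = +-cancelʳ-% f g a
    (trans (cong (_% N) (+-comm f a)) (trans eq (cong (_% N) (+-comm a g))))

  steps-≡ : ∀ {a f x} → a + f ≡ x → Steps a f x
  steps-≡ eq = steps (cong (_% N) eq)

  steps-wrap : ∀ {a f x} → a + f ≡ x + N → Steps a f x
  steps-wrap {x = x} eq = steps (trans (cong (_% N) eq) ([m+n]%n≡m%n x N))

  steps-trans : ∀ {a f y g x} → Steps a f y → Steps y g x → Steps a (f + g) x
  steps-trans {a} {f} {y} {g} {x} (steps a→y) (steps y→x) = steps (begin
    (a + (f + g)) % N      ≡⟨ cong (_% N) (+-assoc a f g) ⟨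
    (a + f + g) % N        ≡⟨ %-absorbˡ (a + f) g ⟨
    ((a + f) % N + g) % N  ≡⟨ cong (λ r → (r + g) % N) a→y ⟩
    (y % N + g) % N        ≡⟨ %-absorbˡ y g ⟩
    (y + g) % N            ≡⟨ y→x ⟩
    x % N                  ∎)
    where open ≡-Reasoning

  steps-split : ∀ {w e a d b} → Steps w e a → Steps w (e + d) b → Steps a d b
  steps-split {w} {e} {a} {d} {b} (steps w→a) (steps w→b) = steps (begin
    (a + d) % N            ≡⟨ %-absorbˡ a d ⟨
    (a % N + d) % N        ≡⟨ cong (λ r → (r + d) % N) w→a ⟨
    ((w + e) % N + d) % N  ≡⟨ %-absorbˡ (w + e) d ⟩
    (w + e + d) % N        ≡⟨ cong (_% N) (+-assoc w e d) ⟩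
    (w + (e + d)) % N      ≡⟨ w→b ⟩
    b % N                  ∎)
    where open ≡-Reasoning

  steps-cancel : ∀ {a d s w b} → Steps a (d + s) w → Steps b s w → Steps a d b
  steps-cancel {a} {d} {s} {w} {b} (steps a→w) (steps b→w) = steps (+-cancelʳ-% (a + d) b s
    (trans (cong (_% N) (+-assoc a d s)) (trans a→w (sym b→w))))

  steps-loop : ∀ {a f} → Steps a f a → f % N ≡ 0
  steps-loop {a} {f} (steps a→a) =
    trans (+-cancelˡ-% a f 0 (trans a→a (cong (_% N) (sym (+-identityʳ a)))))
          (m<n⇒m%n≡m (>-nonZero⁻¹ N))

  half<N : ∀ {f} → f + f ≤ N → f < N
  half<N {zero}  _ = >-nonZero⁻¹ N
  half<N {suc f} f+f≤N = ≤-trans (s≤s (m≤n+m (suc f) f)) f+f≤N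

  apart-minimal : ∀ {a b f e} → f + f ≤ N → Apart f a b → Apart e a b → f ≤ e
  apart-minimal {f = f} {e} short = λ where
      (inj₁ (steps a→b)) (inj₁ (steps a→b′)) → same (+-cancelˡ-% _ f e (trans a→b (sym a→b′)))
      (inj₂ (steps b→a)) (inj₂ (steps b→a′)) → same (+-cancelˡ-% _ f e (trans b→a (sym b→a′)))
      (inj₁ a→b) (inj₂ b→a) → around (steps-loop (steps-trans a→b b→a))
      (inj₂ b→a) (inj₁ a→b) → around (steps-loop (steps-trans b→a a→b))
    where
    same : f % N ≡ e % N → f ≤ e
    same eq = subst (_≤ e) (trans (sym eq) (m<n⇒m%n≡m (half<N short))) (m%n≤m e N)
    around : (f + e) % N ≡ 0 → f ≤ e
    around eq with f + e <? N
    ... | yes f+e<N = subst (_≤ e) (sym (m+n≡0⇒m≡0 f (trans (sym (m<n⇒m%n≡m f+e<N)) eq))) z≤n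
    ... | no  f+e≮N = +-cancelˡ-≤ f f e (≤-trans short (≮⇒≥ f+e≮N))

  converge-≤ : ∀ {a b w e s} → s ≤ e → Steps a e w → Steps b s w → ∃[ g ] g ≤ e × Steps a g b
  converge-≤ {a} {w = w} {s = s} s≤e a→w b→w with m≤n⇒∃[o]m+o≡n s≤e
  ... | d , refl = d , m≤n+m d s , steps-cancel (subst (λ f → Steps a f w) (+-comm s d) a→w) b→w

  diverge-≤ : ∀ {w a b e s} → e ≤ s → Steps w e a → Steps w s b → ∃[ g ] g ≤ s × Steps a g b
  diverge-≤ {e = e} e≤s w→a w→b with m≤n⇒∃[o]m+o≡n e≤s
  ... | d , refl = d , m≤n+m d e , steps-split w→a w→b

  apart-trans : ∀ {a w b e s} → Apart e a w → Apart s w b → ∃[ g ] g ≤ e + s × Apart g a b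
  apart-trans {e = e} {s} (inj₁ a→w) (inj₁ w→b) = e + s , ≤-refl , inj₁ (steps-trans a→w w→b)
  apart-trans {e = e} {s} (inj₂ w→a) (inj₂ b→w) =
    s + e , ≤-reflexive (+-comm s e) , inj₂ (steps-trans b→w w→a)
  apart-trans {e = e} {s} (inj₁ a→w) (inj₂ b→w) with ≤-total s e
  ... | inj₁ s≤e = let g , g≤e , a→b = converge-≤ s≤e a→w b→w in
                   g , ≤-trans g≤e (m≤m+n e s) , inj₁ a→b
  ... | inj₂ e≤s = let g , g≤s , b→a = converge-≤ e≤s b→w a→w in
                   g , ≤-trans g≤s (m≤n+m s e) , inj₂ b→a
  apart-trans {e = e} {s} (inj₂ w→a) (inj₁ w→b) with ≤-total e s
  ... | inj₁ e≤s = let g , g≤s , a→b = diverge-≤ e≤s w→a w→b in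
                   g , ≤-trans g≤s (m≤n+m s e) , inj₁ a→b
  ... | inj₂ s≤e = let g , g≤e , b→a = diverge-≤ s≤e w→b w→a in
                   g , ≤-trans g≤e (m≤m+n e s) , inj₂ b→a

module Circulant (N : ℕ) .{{_ : NonZero N}} (4<N : 4 < N) where

  open Cyclic N public

  diffIs⇒steps : ∀ {i j : Fin N} {s} → T (diffIs N i j s) → Steps (toℕ i) s (toℕ j)
  diffIs⇒steps {i} {j} d = steps (trans (sym (≡ᵇ⇒≡ _ _ d)) (sym (m<n⇒m%n≡m (toℕ<n j))))

  steps⇒diffIs : ∀ {i j : Fin N} {s} → Steps (toℕ i) s (toℕ j) → T (diffIs N i j s)
  steps⇒diffIs {i} {j} (steps i→j) = ≡⇒≡ᵇ _ _ (sym (trans i→j (m<n⇒m%n≡m (toℕ<n j))))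

  adj⇒apart : ∀ {i j} → T (adj N i j) → ∃[ s ] s ≤ 4 × Apart s (toℕ i) (toℕ j)
  adj⇒apart {i} {j} p with toℕ i ≡ᵇ toℕ j
  ... | false =
    T-∨-elim (fwd 1≤4) (T-∨-elim (fwd 2≤4) (T-∨-elim (fwd 3≤4) (T-∨-elim (fwd ≤-refl)
      (T-∨-elim (bwd 1≤4) (T-∨-elim (bwd 2≤4) (T-∨-elim (bwd 3≤4) (bwd ≤-refl))))))) p
    where
    1≤4 = m≤m+n 1 3
    2≤4 = m≤m+n 2 2
    3≤4 = m≤m+n 3 1
    fwd : ∀ {s} → s ≤ 4 → T (diffIs N i j s) → ∃[ s ] s ≤ 4 × Apart s (toℕ i) (toℕ j)
    fwd s≤4 d = _ , s≤4 , inj₁ (diffIs⇒steps d)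
    bwd : ∀ {s} → s ≤ 4 → T (diffIs N j i s) → ∃[ s ] s ≤ 4 × Apart s (toℕ i) (toℕ j)
    bwd s≤4 d = _ , s≤4 , inj₂ (diffIs⇒steps d)

  no-short-loop : ∀ {a s} → 1 ≤ s → s ≤ 4 → ¬ Steps a s a
  no-short-loop {s = s} 1≤s s≤4 a→a =
    <⇒≢ 1≤s (sym (trans (sym (m<n⇒m%n≡m (≤-<-trans s≤4 4<N))) (steps-loop a→a)))

  steps-distinct : ∀ {a s b} → 1 ≤ s → s ≤ 4 → Steps a s b → a mod N ≢ b mod N
  steps-distinct {a} {s} {b} 1≤s s≤4 (steps a→b) a≡b = no-short-loop 1≤s s≤4 (steps (begin
    (a + s) % N          ≡⟨ a→b ⟩
    b % N                ≡⟨ toℕ-fromℕ< _ ⟨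
    toℕ (b mod N)        ≡⟨ cong toℕ a≡b ⟨
    toℕ (a mod N)        ≡⟨ toℕ-fromℕ< _ ⟩
    a % N                ∎))
    where open ≡-Reasoning

  apart⇒adj : ∀ {i j s} → 1 ≤ s → s ≤ 4 → Apart s (toℕ i) (toℕ j) → T (adj N i j)
  apart⇒adj {i} {j} {s} 1≤s s≤4 i~j with toℕ i ≡ᵇ toℕ j in i≡ᵇj
  ... | true = contradiction (loop i~j) (no-short-loop 1≤s s≤4)
    where
    i≡j = ≡ᵇ⇒≡ (toℕ i) (toℕ j) (subst T (sym i≡ᵇj) _)
    loop : Apart s (toℕ i) (toℕ j) → Steps (toℕ i) s (toℕ i)
    loop (inj₁ i→j) = subst (Steps (toℕ i) s) (sym i≡j) i→j
    loop (inj₂ j→i) = subst (λ a → Steps a s (toℕ i)) (sym i≡j) j→i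
  ... | false = disjunct s 1≤s s≤4 i~j
    where
    ʳ = T-∨-introʳ
    ˡ = T-∨-introˡ
    f b : ℕ → Bool
    f = diffIs N i j
    b = diffIs N j i
    disjunct : ∀ s → 1 ≤ s → s ≤ 4 → Apart s (toℕ i) (toℕ j) →
      T (f 1 ∨ f 2 ∨ f 3 ∨ f 4 ∨ b 1 ∨ b 2 ∨ b 3 ∨ b 4)
    disjunct 1 _ _ (inj₁ i→j) = ˡ (f 1) (steps⇒diffIs i→j)
    disjunct 2 _ _ (inj₁ i→j) = ʳ (f 1) (ˡ (f 2) (steps⇒diffIs i→j))
    disjunct 3 _ _ (inj₁ i→j) = ʳ (f 1) (ʳ (f 2) (ˡ (f 3) (steps⇒diffIs i→j)))
    disjunct 4 _ _ (inj₁ i→j) = ʳ (f 1) (ʳ (f 2) (ʳ (f 3) (ˡ (f 4) (steps⇒diffIs i→j))))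
    disjunct 1 _ _ (inj₂ j→i) =
      ʳ (f 1) (ʳ (f 2) (ʳ (f 3) (ʳ (f 4) (ˡ (b 1) (steps⇒diffIs j→i)))))
    disjunct 2 _ _ (inj₂ j→i) =
      ʳ (f 1) (ʳ (f 2) (ʳ (f 3) (ʳ (f 4) (ʳ (b 1) (ˡ (b 2) (steps⇒diffIs j→i))))))
    disjunct 3 _ _ (inj₂ j→i) =
      ʳ (f 1) (ʳ (f 2) (ʳ (f 3) (ʳ (f 4) (ʳ (b 1) (ʳ (b 2) (ˡ (b 3) (steps⇒diffIs j→i)))))))
    disjunct 4 _ _ (inj₂ j→i) =
      ʳ (f 1) (ʳ (f 2) (ʳ (f 3) (ʳ (f 4) (ʳ (b 1) (ʳ (b 2) (ʳ (b 3) (steps⇒diffIs j→i)))))))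
    disjunct (suc (suc (suc (suc (suc _))))) _ (s≤s (s≤s (s≤s (s≤s ())))) _

  steps-to-mod : ∀ a f → Steps a f (toℕ ((a + f) mod N))
  steps-to-mod a f = steps (sym (trans (cong (_% N) (toℕ-fromℕ< _)) (m%n%n≡m%n (a + f) N)))

  apart-zero : ∀ {u v : Fin N} → Apart 0 (toℕ u) (toℕ v) → toℕ u ≡ toℕ v
  apart-zero {u} {v} = λ where
      (inj₁ (steps u→v)) → reduce (trans (cong (_% N) (sym (+-identityʳ (toℕ u)))) u→v)
      (inj₂ (steps v→u)) → sym (reduce (trans (cong (_% N) (sym (+-identityʳ (toℕ v)))) v→u))
    where
    reduce : ∀ {a b : Fin N} → toℕ a % N ≡ toℕ b % N → toℕ a ≡ toℕ b
    reduce {a} {b} eq =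
      trans (sym (m<n⇒m%n≡m (toℕ<n a))) (trans eq (m<n⇒m%n≡m (toℕ<n b)))

  ball⇒apart : ∀ t {u v} → T (ball N t u v) → ∃[ e ] e ≤ t * 4 × Apart e (toℕ u) (toℕ v)
  ball⇒apart zero {u} p = 0 , z≤n , inj₁ (steps-≡ (trans (+-identityʳ (toℕ u)) (≡ᵇ⇒≡ _ _ p)))
  ball⇒apart (suc t) {u} {v} = T-∨-elim earlier (later ∘ find ∘ any⁻ _ (allFin N))
    where
    earlier : T (ball N t u v) → ∃[ e ] e ≤ suc t * 4 × Apart e (toℕ u) (toℕ v)
    earlier p = let e , e≤ , u~v = ball⇒apart t p in e , ≤-trans e≤ (m≤n+m (t * 4) 4) , u~v
    later : ∃[ w ] _ × T (ball N t u w ∧ adj N w v) →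
            ∃[ e ] e ≤ suc t * 4 × Apart e (toℕ u) (toℕ v)
    later (w , _ , p) =
      let ball-w , adj-w = Equivalence.to T-∧ p
          e , e≤ , u~w = ball⇒apart t ball-w
          s , s≤4 , w~v = adj⇒apart adj-w
          g , g≤ , u~v = apart-trans u~w w~v
      in g , ≤-trans g≤ (≤-trans (+-mono-≤ e≤ s≤4) (≤-reflexive (+-comm (t * 4) 4))) , u~v

  apart⇒ball : ∀ t {u v e} → e ≤ t * 4 → Apart e (toℕ u) (toℕ v) → T (ball N t u v)
  apart⇒ball zero    {u} {v} z≤n u~v = ≡⇒≡ᵇ _ _ (apart-zero u~v)
  apart⇒ball (suc t) {u} {v} {e} e≤ u~v with e ≤? t * 4
  ... | yes e≤′ = T-∨-introˡ (ball N t u v) (apart⇒ball t e≤′ u~v)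
  ... | no  e≰ with m≤n⇒∃[o]m+o≡n (≰⇒> e≰)
  ...   | d , refl = T-∨-introʳ (ball N t u v) (any⁺ _ (let w , w-between = via u~v in
                                                        lose (∈-allFin w) w-between))
    where
    d≤3 : d ≤ 3
    d≤3 = +-cancelˡ-≤ (suc (t * 4)) d 3
            (subst (suc (t * 4) + d ≤_) (trans (+-comm 4 (t * 4)) (+-suc (t * 4) 3)) e≤)
    step : Fin N → Set
    step w = T (ball N t u w ∧ adj N w v)
    edge : ∀ {w} → Apart (suc d) (toℕ w) (toℕ v) → T (adj N w v)
    edge = apart⇒adj (s≤s z≤n) (s≤s d≤3)
    via : Apart (suc (t * 4) + d) (toℕ u) (toℕ v) → ∃[ w ] step w
    via (inj₁ u→v) = w , Equivalence.from T-∧ (apart⇒ball t ≤-refl (inj₁ u→w) , edge (inj₁ w→v))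
      where
      w = (toℕ u + t * 4) mod N
      u→w = steps-to-mod (toℕ u) (t * 4)
      w→v = steps-split u→w (subst (λ f → Steps (toℕ u) f (toℕ v)) (sym (+-suc (t * 4) d)) u→v)
    via (inj₂ v→u) = w , Equivalence.from T-∧ (apart⇒ball t ≤-refl (inj₂ w→u) , edge (inj₂ v→w))
      where
      w = (toℕ v + suc d) mod N
      v→w = steps-to-mod (toℕ v) (suc d)
      w→u = steps-split v→w (subst (λ f → Steps (toℕ v) f (toℕ u)) (cong suc (+-comm (t * 4) d)) v→u)

  dist-short : ∀ {u v f} → f + f ≤ N → Apart f (toℕ u) (toℕ v) → dist N u v ≡ ⌈ f /4⌉
  dist-short {u} {v} {f} short u~v =
    firstFrom-least N 0 ⌈ f /4⌉ reached least z≤n (≤-<-trans (⌈n/4⌉≤n f) (half<N short))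
    where
    reached : T (ball N ⌈ f /4⌉ u v)
    reached = apart⇒ball ⌈ f /4⌉ (n≤⌈n/4⌉*4 f) u~v
    least : ∀ t → T (ball N t u v) → ⌈ f /4⌉ ≤ t
    least t b = let e , e≤ , u~v′ = ball⇒apart t b in
                n≤t*4⇒⌈n/4⌉≤t f (≤-trans (apart-minimal short u~v u~v′) e≤)

  dist-arcs : ∀ {u v f g} → f + g ≡ N → Steps (toℕ u) f (toℕ v) → dist N u v ≡ ⌈ f /4⌉ ⊓ ⌈ g /4⌉
  dist-arcs {u} {v} {f} {g} f+g≡N u→v with ≤-total f g
  ... | inj₁ f≤g = trans (dist-short (subst (f + f ≤_) f+g≡N (+-monoʳ-≤ f f≤g)) (inj₁ u→v))
                         (sym (m≤n⇒m⊓n≡m (⌈/4⌉-mono-≤ f≤g)))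
  ... | inj₂ g≤f = trans (dist-short (subst (g + g ≤_) (trans (+-comm g f) f+g≡N) (+-monoʳ-≤ g g≤f))
                                     (inj₂ (steps-split u→v u→u)))
                         (sym (m≥n⇒m⊓n≡n (⌈/4⌉-mono-≤ g≤f)))
    where
    u→u : Steps (toℕ u) (f + g) (toℕ u)
    u→u = steps (trans (cong (λ n → (toℕ u + n) % N) f+g≡N) ([m+n]%n≡m%n (toℕ u) N))

  steps-modˡ : ∀ {a f x} → Steps a f x → Steps (toℕ (a mod N)) f x
  steps-modˡ {a} {f} (steps a→x) =
    steps (trans (cong (λ r → (r + f) % N) (toℕ-fromℕ< _)) (trans (%-absorbˡ a f) a→x))

  steps-modʳ : ∀ {x f a} → Steps x f a → Steps x f (toℕ (a mod N))
  steps-modʳ {a = a} (steps x→a) =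
    steps (trans x→a (sym (trans (cong (_% N) (toℕ-fromℕ< _)) (m%n%n≡m%n a N))))

  dist-from : ∀ {a f x} → f + f ≤ N → Steps a f x → dist N (a mod N) (x mod N) ≡ ⌈ f /4⌉
  dist-from short a→x = dist-short short (inj₁ (steps-modˡ (steps-modʳ a→x)))

  dist-to : ∀ {a f x} → f + f ≤ N → Steps x f a → dist N (a mod N) (x mod N) ≡ ⌈ f /4⌉
  dist-to short x→a = dist-short short (inj₂ (steps-modˡ (steps-modʳ x→a)))

  equidistant-both-ways : ∀ {a b x s e e′} → Steps a s b → Steps b e x →
    s + e + e′ ≡ N → ⌈ e + s /4⌉ ≡ ⌈ e /4⌉ → ⌈ e′ + s /4⌉ ≡ ⌈ e′ /4⌉ →
    dist N (a mod N) (x mod N) ≡ dist N (b mod N) (x mod N)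
  equidistant-both-ways {a} {b} {x} {s} {e} {e′} a→b b→x total forward backward = begin
    dist N (a mod N) (x mod N)  ≡⟨ dist-arcs total (steps-modˡ (steps-modʳ (steps-trans a→b b→x))) ⟩
    ⌈ s + e /4⌉ ⊓ ⌈ e′ /4⌉       ≡⟨ cong₂ _⊓_ (trans (cong ⌈_/4⌉ (+-comm s e)) forward) (sym backward) ⟩
    ⌈ e /4⌉ ⊓ ⌈ e′ + s /4⌉       ≡⟨ dist-arcs total′ (steps-modˡ (steps-modʳ b→x)) ⟨
    dist N (b mod N) (x mod N)  ∎
    where
    open ≡-Reasoning
    total′ : e + (e′ + s) ≡ N
    total′ = trans (rearrange s e e′) total
      where
      rearrange : ∀ s e e′ → e + (e′ + s) ≡ s + e + e′
      rearrange = solve-∀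

  equidistant-by-residue : ∀ {a b x s ρ′ M} .{{_ : NonZero M}} t ρ → N ≡ M * 4 →
    Steps a s b → Steps b (t * 4 + ρ) x → s + ρ + ρ′ ≡ 4 →
    ⌈ ρ + s /4⌉ ≡ ⌈ ρ /4⌉ → ⌈ ρ′ + s /4⌉ ≡ ⌈ ρ′ /4⌉ →
    dist N (a mod N) (x mod N) ≡ dist N (b mod N) (x mod N)
  -- Reducing t modulo M shortens the arc from b to x below N, so that the complementary
  -- arc w * 4 + ρ′ exists.
  equidistant-by-residue {a} {b} {x} {s} {ρ′} {M} t ρ N≡M*4 a→b (steps b→x) residues forward backward
    with m≤n⇒∃[o]m+o≡n (m%n<n t M)
  ... | w , t₀+w≡M =
    equidistant-both-ways a→b b→x′ total (⌈/4⌉-shift t₀ forward) (⌈/4⌉-shift w backward)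
    where
    open ≡-Reasoning
    t₀ = t % M
    q = t / M
    shift : b + (t * 4 + ρ) ≡ b + (t₀ * 4 + ρ) + q * N
    shift = begin
      b + (t * 4 + ρ)                ≡⟨ cong (λ t → b + (t * 4 + ρ)) (m≡m%n+[m/n]*n t M) ⟩
      b + ((t₀ + q * M) * 4 + ρ)      ≡⟨ regroup b t₀ q M ρ ⟩
      b + (t₀ * 4 + ρ) + q * (M * 4)  ≡⟨ cong (λ n → b + (t₀ * 4 + ρ) + q * n) N≡M*4 ⟨
      b + (t₀ * 4 + ρ) + q * N        ∎
      where
      regroup : ∀ b t₀ q M ρ → b + ((t₀ + q * M) * 4 + ρ) ≡ b + (t₀ * 4 + ρ) + q * (M * 4)
      regroup = solve-∀
    b→x′ : Steps b (t₀ * 4 + ρ) x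
    b→x′ = steps (begin
      (b + (t₀ * 4 + ρ)) % N          ≡⟨ [m+kn]%n≡m%n (b + (t₀ * 4 + ρ)) q N ⟨
      (b + (t₀ * 4 + ρ) + q * N) % N  ≡⟨ cong (_% N) shift ⟨
      (b + (t * 4 + ρ)) % N           ≡⟨ b→x ⟩
      x % N                           ∎)
    total : s + (t₀ * 4 + ρ) + (w * 4 + ρ′) ≡ N
    total = begin
      s + (t₀ * 4 + ρ) + (w * 4 + ρ′)  ≡⟨ regroup s t₀ ρ w ρ′ ⟩
      s + ρ + ρ′ + (t₀ + w) * 4        ≡⟨ cong (_+ (t₀ + w) * 4) residues ⟩
      suc (t₀ + w) * 4                 ≡⟨ cong (_* 4) t₀+w≡M ⟩
      M * 4                            ≡⟨ N≡M*4 ⟨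
      N                                ∎
      where
      regroup : ∀ s t₀ ρ w ρ′ → s + (t₀ * 4 + ρ) + (w * 4 + ρ′) ≡ s + ρ + ρ′ + (t₀ + w) * 4
      regroup = solve-∀

  equidistant-ahead : ∀ {a b x s} t ρ → Steps a s b → Steps b (t * 4 + ρ) x →
    (t * 4 + ρ + s) + (t * 4 + ρ + s) ≤ N → ⌈ ρ + s /4⌉ ≡ ⌈ ρ /4⌉ →
    dist N (a mod N) (x mod N) ≡ dist N (b mod N) (x mod N)
  equidistant-ahead {a} {b} {x} {s} t ρ a→b b→x short same-block = begin
    dist N (a mod N) (x mod N)  ≡⟨ dist-from short (subst (λ f → Steps a f x) (+-comm s e)
                                                          (steps-trans a→b b→x)) ⟩
    ⌈ e + s /4⌉                 ≡⟨ ⌈/4⌉-shift t same-block ⟩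
    ⌈ e /4⌉                     ≡⟨ dist-from (≤-trans (+-mono-≤ (m≤m+n e s) (m≤m+n e s)) short) b→x ⟨
    dist N (b mod N) (x mod N)  ∎
    where
    open ≡-Reasoning
    e = t * 4 + ρ

  equidistant-behind : ∀ {a b x s} t ρ → Steps a s b → Steps x (t * 4 + ρ) a →
    (t * 4 + ρ + s) + (t * 4 + ρ + s) ≤ N → ⌈ ρ + s /4⌉ ≡ ⌈ ρ /4⌉ →
    dist N (a mod N) (x mod N) ≡ dist N (b mod N) (x mod N)
  equidistant-behind {a} {b} {x} {s} t ρ a→b x→a short same-block = begin
    dist N (a mod N) (x mod N)  ≡⟨ dist-to (≤-trans (+-mono-≤ (m≤m+n e s) (m≤m+n e s)) short) x→a ⟩
    ⌈ e /4⌉                     ≡⟨ ⌈/4⌉-shift t same-block ⟨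
    ⌈ e + s /4⌉                 ≡⟨ dist-to short (steps-trans x→a a→b) ⟨
    dist N (b mod N) (x mod N)  ∎
    where
    open ≡-Reasoning
    e = t * 4 + ρ

4<ord : ∀ k → 4 < ord k
4<ord k = s≤s (≤-trans (m≤m+n 4 3) (m≤n+m 7 (8 * k)))

-- N is spelled out rather than written ord k, so that the ring solver can see it.
module G (k : ℕ) = Circulant (suc (8 * k + 7)) (4<ord k)
open G

ord≡[2k+2]*4 : ∀ k → suc (8 * k + 7) ≡ suc (2 * k + 1) * 4
ord≡[2k+2]*4 = solve-∀

-- A record for the same reason as Steps.
record Equidistant (k x a b : ℕ) : Set where
  constructor equidistant
  field
    same-dist : dist (ord k) (vx k a) (vx k x) ≡ dist (ord k) (vx k b) (vx k x)

A₀ˡ-steps : ∀ k → Steps k (4 * k + 4) 1 (4 * k + 5)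
A₀ˡ-steps k = steps-≡ k (+-assoc (4 * k) 4 1)

A₀ʳ-steps : ∀ k → Steps k (4 * k + 5) 1 (4 * k + 6)
A₀ʳ-steps k = steps-≡ k (+-assoc (4 * k) 5 1)

Aₖ-steps : ∀ k → Steps k (8 * k + 4) 1 (8 * k + 5)
Aₖ-steps k = steps-≡ k (+-assoc (8 * k) 4 1)

B₁-steps : ∀ k → Steps k (8 * k + 7) 2 1
B₁-steps k = steps-wrap k (solve (k ∷ []))

B₂-steps : ∀ k j → Steps k (4 * j + 2) 2 (4 * j + 4)
B₂-steps k j = steps-≡ k (+-assoc (4 * j) 2 2)

B₃-steps : ∀ k j → Steps k (4 * j + 1) 2 (4 * j + 3)
B₃-steps k j = steps-≡ k (+-assoc (4 * j) 1 2)

by-residue : ∀ {k a b x s ρ′} t ρ → Steps k a s b → Steps k b (t * 4 + ρ) x → s + ρ + ρ′ ≡ 4 →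
  ⌈ ρ + s /4⌉ ≡ ⌈ ρ /4⌉ → ⌈ ρ′ + s /4⌉ ≡ ⌈ ρ′ /4⌉ → Equidistant k x a b
by-residue {k} t ρ a→b b→x residues forward backward = equidistant
  (equidistant-by-residue k {M = suc (2 * k + 1)} t ρ (ord≡[2k+2]*4 k)
                          a→b b→x residues forward backward)

ahead : ∀ {k a b x s} t ρ → Steps k a s b → Steps k b (t * 4 + ρ) x →
  (t * 4 + ρ + s) + (t * 4 + ρ + s) ≤ suc (8 * k + 7) → ⌈ ρ + s /4⌉ ≡ ⌈ ρ /4⌉ → Equidistant k x a b
ahead {k} t ρ a→b b→x short same-block =
  equidistant (equidistant-ahead k t ρ a→b b→x short same-block)

behind : ∀ {k a b x s} t ρ → Steps k a s b → Steps k x (t * 4 + ρ) a →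
  (t * 4 + ρ + s) + (t * 4 + ρ + s) ≤ suc (8 * k + 7) → ⌈ ρ + s /4⌉ ≡ ⌈ ρ /4⌉ → Equidistant k x a b
behind {k} t ρ a→b x→a short same-block =
  equidistant (equidistant-behind k t ρ a→b x→a short same-block)

m+o≡n⇒m≤n : ∀ {m n} o → m + o ≡ n → m ≤ n
m+o≡n⇒m≤n {m} o eq = subst (m ≤_) eq (m≤m+n m o)

A₀ʳ-r0 : ∀ k q → Equidistant k (q * 4) (4 * k + 5) (4 * k + 6)
A₀ʳ-r0 k q = by-residue (q + k) 2 (A₀ʳ-steps k) (steps-wrap k (solve (k ∷ q ∷ []))) refl refl refl

B₃-r0 : ∀ {k m′} q → m′ ≤ k → Equidistant k (q * 4) (4 * m′ + 1) (4 * m′ + 3)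
B₃-r0 {m′ = m′} q m′≤k with m≤n⇒∃[o]m+o≡n m′≤k
... | d , refl = by-residue (q + m′ + d + d + 1) 1 (B₃-steps (m′ + d) m′)
                   (steps-wrap (m′ + d) (solve (q ∷ m′ ∷ d ∷ []))) refl refl refl

Aₖ-r0 : ∀ {k} q → q ≤ k → Equidistant k (q * 4) (8 * k + 4) (8 * k + 5)
Aₖ-r0 q q≤k with m≤n⇒∃[o]m+o≡n q≤k
... | p , refl = ahead q 3 (Aₖ-steps (q + p)) (steps-wrap (q + p) (solve (q ∷ p ∷ [])))
                   (m+o≡n⇒m≤n (p * 8) (solve (q ∷ p ∷ []))) refl

B₁-r0 : ∀ k → Equidistant k (suc k * 4) (8 * k + 7) 1
B₁-r0 k = equidistant (trans (dist-to k short x→a) (sym (dist-from k short b→x)))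
  where
  x→a : Steps k (suc k * 4) (k * 4 + 3) (8 * k + 7)
  x→a = steps-≡ k (solve (k ∷ []))
  b→x : Steps k 1 (k * 4 + 3) (suc k * 4)
  b→x = steps-≡ k (solve (k ∷ []))
  short : (k * 4 + 3) + (k * 4 + 3) ≤ suc (8 * k + 7)
  short = m+o≡n⇒m≤n 2 (solve (k ∷ []))

A₀ˡ-r0 : ∀ {k} p → p ≤ k → Equidistant k ((2 + k + p) * 4) (4 * k + 4) (4 * k + 5)
A₀ˡ-r0 p p≤k with m≤n⇒∃[o]m+o≡n p≤k
... | w , refl = ahead p 3 (A₀ˡ-steps (p + w)) (steps-≡ (p + w) (solve (p ∷ w ∷ [])))
                   (m+o≡n⇒m≤n (w * 8) (solve (p ∷ w ∷ []))) refl

B₂-r1 : ∀ {k m} q → m ≤ k → Equidistant k (1 + q * 4) (4 * m + 2) (4 * m + 4)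
B₂-r1 {m = m} q m≤k with m≤n⇒∃[o]m+o≡n m≤k
... | d , refl = by-residue (q + m + d + d + 1) 1 (B₂-steps (m + d) m)
                   (steps-wrap (m + d) (solve (q ∷ m ∷ d ∷ []))) refl refl refl

B₃-r1 : ∀ {k m′} q → m′ < q → q ≤ suc k → Equidistant k (1 + q * 4) (4 * m′ + 1) (4 * m′ + 3)
B₃-r1 {m′ = m′} q m′<q q≤k+1 with m≤n⇒∃[o]m+o≡n m′<q
... | t , refl with m≤n⇒∃[o]m+o≡n (≤-pred q≤k+1)
...   | u , refl = ahead t 2 (B₃-steps (m′ + t + u) m′) (steps-≡ (m′ + t + u) (solve (m′ ∷ t ∷ [])))
                     (m+o≡n⇒m≤n ((m′ + u) * 8) (solve (m′ ∷ t ∷ u ∷ []))) refl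

A₀ˡ-r1 : ∀ {k} q → q ≤ k → Equidistant k (1 + q * 4) (4 * k + 4) (4 * k + 5)
A₀ˡ-r1 q q≤k with m≤n⇒∃[o]m+o≡n q≤k
... | p , refl = behind p 3 (A₀ˡ-steps (q + p)) (steps-≡ (q + p) (solve (q ∷ p ∷ [])))
                   (m+o≡n⇒m≤n (q * 8) (solve (q ∷ p ∷ []))) refl

Aₖ-r1 : ∀ {k} → 1 ≤ k → Equidistant k (1 + suc k * 4) (8 * k + 4) (8 * k + 5)
Aₖ-r1 {suc k} _ = behind k 3 (Aₖ-steps (suc k)) (steps-≡ (suc k) (solve (k ∷ [])))
                    (m+o≡n⇒m≤n 8 (solve (k ∷ []))) refl

A₀ʳ-r1 : ∀ {k} p → p ≤ k → Equidistant k (1 + (2 + k + p) * 4) (4 * k + 5) (4 * k + 6)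
A₀ʳ-r1 p p≤k with m≤n⇒∃[o]m+o≡n p≤k
... | w , refl = ahead p 3 (A₀ʳ-steps (p + w)) (steps-≡ (p + w) (solve (p ∷ w ∷ [])))
                   (m+o≡n⇒m≤n (w * 8) (solve (p ∷ w ∷ []))) refl

B₁-r1 : ∀ {k} p → p < k → Equidistant k (1 + (2 + k + p) * 4) (8 * k + 7) 1
B₁-r1 p p<k with m≤n⇒∃[o]m+o≡n p<k
... | w , refl = behind w 2 (B₁-steps (suc p + w)) (steps-≡ (suc p + w) (solve (p ∷ w ∷ [])))
                   (m+o≡n⇒m≤n (suc p * 8) (solve (p ∷ w ∷ []))) refl

A₀ˡ-r2 : ∀ k q → Equidistant k (2 + q * 4) (4 * k + 4) (4 * k + 5)
A₀ˡ-r2 k q = by-residue (q + k + 1) 1 (A₀ˡ-steps k) (steps-wrap k (solve (k ∷ q ∷ []))) refl refl refl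

Aₖ-r2 : ∀ k q → Equidistant k (2 + q * 4) (8 * k + 4) (8 * k + 5)
Aₖ-r2 k q = by-residue (q + 1) 1 (Aₖ-steps k) (steps-wrap k (solve (k ∷ q ∷ []))) refl refl refl

B₁-r2 : ∀ k q → Equidistant k (2 + q * 4) (8 * k + 7) 1
B₁-r2 k q = by-residue q 1 (B₁-steps k) (steps-≡ k (solve (q ∷ []))) refl refl refl

A₀ˡ-r3 : ∀ k q → Equidistant k (3 + q * 4) (4 * k + 4) (4 * k + 5)
A₀ˡ-r3 k q = by-residue (q + k + 1) 2 (A₀ˡ-steps k) (steps-wrap k (solve (k ∷ q ∷ []))) refl refl refl

A₀ʳ-r3 : ∀ k q → Equidistant k (3 + q * 4) (4 * k + 5) (4 * k + 6)
A₀ʳ-r3 k q = by-residue (q + k + 1) 1 (A₀ʳ-steps k) (steps-wrap k (solve (k ∷ q ∷ []))) refl refl refl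

Aₖ-r3 : ∀ k q → Equidistant k (3 + q * 4) (8 * k + 4) (8 * k + 5)
Aₖ-r3 k q = by-residue (q + 1) 2 (Aₖ-steps k) (steps-wrap k (solve (k ∷ q ∷ []))) refl refl refl

data Pair : Set where
  A₀ˡ A₀ʳ Aₖ B₁ B₂ B₃ : Pair

points : (k m m′ : ℕ) → Pair → ℕ × ℕ
points k m m′ A₀ˡ = 4 * k + 4  , 4 * k + 5
points k m m′ A₀ʳ = 4 * k + 5  , 4 * k + 6
points k m m′ Aₖ  = 8 * k + 4  , 8 * k + 5
points k m m′ B₁  = 8 * k + 7  , 1
points k m m′ B₂  = 4 * m + 2  , 4 * m + 4
points k m m′ B₃  = 4 * m′ + 1 , 4 * m′ + 3

Unresolved : (k m m′ x : ℕ) → Pair → Set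
Unresolved k m m′ x P = Equidistant k x (proj₁ (points k m m′ P)) (proj₂ (points k m m′ P))

encode : Pair → ℕ
encode A₀ˡ = 0
encode A₀ʳ = 1
encode Aₖ  = 2
encode B₁  = 3
encode B₂  = 4
encode B₃  = 5

decode : ℕ → Pair
decode 0 = A₀ˡ
decode 1 = A₀ʳ
decode 2 = Aₖ
decode 3 = B₁
decode 4 = B₂
decode _ = B₃

decode-encode : ∀ P → decode (encode P) ≡ P
decode-encode A₀ˡ = refl
decode-encode A₀ʳ = refl
decode-encode Aₖ  = refl
decode-encode B₁  = refl
decode-encode B₂  = refl
decode-encode B₃  = refl

_≟ᴾ_ : DecidableEquality Pair
P ≟ᴾ Q = map′ (λ eq → trans (sym (decode-encode P)) (trans (cong decode eq) (decode-encode Q)))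
              (cong encode) (encode P ≟ encode Q)

open import Data.List.Membership.DecPropositional _≟ᴾ_ using (_∈?_)

-- Opened only here: overloading [] and _∷_ above would make the variable lists given to
-- the ring solver ambiguous, which slows checking down dramatically.
open import Data.List.Relation.Unary.All using ([]; _∷_)
open import Data.Vec using ([]; _∷_; here; there)

-- The class of x = r + q * 4: its residue r and, for r ≤ 1, whether x lies before A₀
-- (q ≤ k), in its block (q = k + 1) or after it.
data Class : Set where
  r0-before r0-at r0-after r1-before r1-at r1-after r2 r3 : Class

pairs : Class → List Pair
pairs r0-before = A₀ʳ ∷ B₃ ∷ Aₖ ∷ []
pairs r0-at     = A₀ʳ ∷ B₃ ∷ B₁ ∷ []
pairs r0-after  = A₀ʳ ∷ B₃ ∷ A₀ˡ ∷ []
pairs r1-before = B₂ ∷ B₃ ∷ A₀ˡ ∷ []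
pairs r1-at     = B₂ ∷ B₃ ∷ Aₖ ∷ []
pairs r1-after  = B₂ ∷ A₀ʳ ∷ B₁ ∷ []
pairs r2        = A₀ˡ ∷ Aₖ ∷ B₁ ∷ []
pairs r3        = A₀ˡ ∷ A₀ʳ ∷ Aₖ ∷ []

classes : List Class
classes = r0-before ∷ r0-at ∷ r0-after ∷ r1-before ∷ r1-at ∷ r1-after ∷ r2 ∷ r3 ∷ []

∈-classes : ∀ c → c ∈ classes
∈-classes r0-before = here refl
∈-classes r0-at     = there (here refl)
∈-classes r0-after  = there (there (here refl))
∈-classes r1-before = there (there (there (here refl)))
∈-classes r1-at     = there (there (there (there (here refl))))
∈-classes r1-after  = there (there (there (there (there (here refl)))))
∈-classes r2        = there (there (there (there (there (there (here refl))))))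
∈-classes r3        = there (there (there (there (there (there (there (here refl)))))))

pairs-meet : ∀ c c′ → ∃[ P ] P ∈ pairs c × P ∈ pairs c′
pairs-meet c c′ = find (All.lookup (All.lookup pairwise (∈-classes c)) (∈-classes c′))
  where
  pairwise : All (λ c → All (λ c′ → Any (_∈ pairs c′) (pairs c)) classes) classes
  pairwise = from-yes
    (All.all? (λ c → All.all? (λ c′ → any? (_∈? pairs c′) (pairs c)) classes) classes)

common-pair : ∀ {A : Set} (U : A → Pair → Set) (L : List A) → length L ≤ 2 →
  (∀ {z} → z ∈ L → ∃[ c ] All (U z) (pairs c)) → ∃[ P ] (∀ {z} → z ∈ L → U z P)
common-pair U [] _ _ = A₀ˡ , λ ()
common-pair U (z ∷ []) _ classified =
  let c , u = classified (here refl)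
      P , P∈c , _ = pairs-meet c c
  in P , λ { (here refl) → All.lookup u P∈c }
common-pair U (z ∷ z′ ∷ []) _ classified =
  let c , u = classified (here refl)
      c′ , u′ = classified (there (here refl))
      P , P∈c , P∈c′ = pairs-meet c c′
  in P , λ { (here refl) → All.lookup u P∈c ; (there (here refl)) → All.lookup u′ P∈c′ }
common-pair U (_ ∷ _ ∷ _ ∷ _) (s≤s (s≤s ())) _

data Residue4 : ℕ → Set where
  rem0 : ∀ q → Residue4 (q * 4)
  rem1 : ∀ q → Residue4 (1 + q * 4)
  rem2 : ∀ q → Residue4 (2 + q * 4)
  rem3 : ∀ q → Residue4 (3 + q * 4)

residue4 : ∀ x → Residue4 x
residue4 zero = rem0 0
residue4 (suc x) with residue4 x
... | rem0 q = rem1 q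
... | rem1 q = rem2 q
... | rem2 q = rem3 q
... | rem3 q = rem0 (suc q)

quotient-bound : ∀ {m′ q} → 4 * m′ + 1 < 1 + q * 4 → m′ < q
quotient-bound {m′} {q} lt =
  *-cancelʳ-< 4 m′ q (+-cancelˡ-< 1 (m′ * 4) (q * 4) (subst (_< 1 + q * 4) (rearrange m′) lt))
  where
  rearrange : ∀ m′ → 4 * m′ + 1 ≡ 1 + m′ * 4
  rearrange = solve-∀

beyond-A₀ : ∀ {k p} r → r + (2 + k + p) * 4 < suc (8 * k + 7) → p < k
beyond-A₀ {k} {p} r lt = ≰⇒> λ k≤p → <⇒≱ lt (begin
  suc (8 * k + 7)      ≡⟨ rearrange k ⟩
  (2 + k + k) * 4      ≤⟨ *-monoˡ-≤ 4 (+-monoʳ-≤ (2 + k) k≤p) ⟩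
  (2 + k + p) * 4      ≤⟨ m≤n+m _ r ⟩
  r + (2 + k + p) * 4  ∎)
  where
  open ≤-Reasoning
  rearrange : ∀ k → suc (8 * k + 7) ≡ (2 + k + k) * 4
  rearrange = solve-∀

classify : ∀ {k m m′} → 1 ≤ k → m < m′ → m′ ≤ k → ∀ x → 4 * m′ + 1 < x → x < ord k →
  ∃[ c ] All (Unresolved k m m′ x) (pairs c)
classify {k} {m} {m′} 1≤k m<m′ m′≤k x allowed x<N with residue4 x
... | rem2 q = r2 , A₀ˡ-r2 k q ∷ Aₖ-r2 k q ∷ B₁-r2 k q ∷ []
... | rem3 q = r3 , A₀ˡ-r3 k q ∷ A₀ʳ-r3 k q ∷ Aₖ-r3 k q ∷ []
... | rem0 q with <-cmp q (suc k)
...   | tri< q≤k _ _ = r0-before , A₀ʳ-r0 k q ∷ B₃-r0 q m′≤k ∷ Aₖ-r0 q (≤-pred q≤k) ∷ []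
...   | tri≈ _ refl _ = r0-at , A₀ʳ-r0 k (suc k) ∷ B₃-r0 (suc k) m′≤k ∷ B₁-r0 k ∷ []
...   | tri> _ _ k+1<q with m≤n⇒∃[o]m+o≡n k+1<q
...     | p , refl = r0-after ,
  A₀ʳ-r0 k (2 + k + p) ∷ B₃-r0 (2 + k + p) m′≤k ∷ A₀ˡ-r0 p (<⇒≤ (beyond-A₀ 0 x<N)) ∷ []
classify {k} {m} {m′} 1≤k m<m′ m′≤k x allowed x<N | rem1 q with <-cmp q (suc k)
... | tri< q≤k _ _ =
  r1-before , B₂-r1 q m≤k ∷ B₃-r1 q (quotient-bound {m′} allowed) (<⇒≤ q≤k) ∷ A₀ˡ-r1 q (≤-pred q≤k) ∷ []
  where m≤k = <⇒≤ (<-≤-trans m<m′ m′≤k)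
... | tri≈ _ refl _ =
  r1-at , B₂-r1 (suc k) m≤k ∷ B₃-r1 (suc k) (quotient-bound {m′} allowed) ≤-refl ∷ Aₖ-r1 1≤k ∷ []
  where m≤k = <⇒≤ (<-≤-trans m<m′ m′≤k)
... | tri> _ _ k+1<q with m≤n⇒∃[o]m+o≡n k+1<q
...   | p , refl = r1-after , B₂-r1 (2 + k + p) m≤k ∷ A₀ʳ-r1 p (<⇒≤ p<k) ∷ B₁-r1 p p<k ∷ []
  where
  m≤k = <⇒≤ (<-≤-trans m<m′ m′≤k)
  p<k = beyond-A₀ 1 x<N

in-block : ∀ {A : Set} {Bs : List (List A)} {B a b} → B ∈ Bs → a ∈ B → b ∈ B →
  ∃[ j ] a ∈ lookup Bs j × b ∈ lookup Bs j
in-block B∈ a∈ b∈ = index B∈ , subst (_ ∈_) (lookup-index B∈) a∈ , subst (_ ∈_) (lookup-index B∈) b∈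

pair-in-cluster : ∀ {k} m m′ → 1 ≤ k → ∀ P →
  let a , b = points k m m′ P
  in ∃[ j ] vx k a ∈ lookup (clusterA k m m′) j × vx k b ∈ lookup (clusterA k m m′) j
pair-in-cluster m m′ _ A₀ˡ = in-block (here refl) (here refl) (there (here refl))
pair-in-cluster m m′ _ A₀ʳ = in-block (here refl) (there (here refl)) (there (there (here refl)))
pair-in-cluster {suc k} m m′ _ Aₖ =
  in-block (there (∈-++⁺ˡ (∈-applyUpTo⁺ block (n<1+n k))))
           (here (cong (vx (suc k)) (last-block k))) (there (here (cong (vx (suc k)) (last-block′ k))))
  where
  block : ℕ → List (Fin (ord (suc k)))
  block j = vx (suc k) (4 * suc k + 4 + 4 * suc j) ∷ vx (suc k) (4 * suc k + 5 + 4 * suc j) ∷ []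
  last-block : ∀ k → 8 * suc k + 4 ≡ 4 * suc k + 4 + 4 * suc k
  last-block = solve-∀
  last-block′ : ∀ k → 8 * suc k + 5 ≡ 4 * suc k + 5 + 4 * suc k
  last-block′ = solve-∀
pair-in-cluster m m′ _ B₁ = in-block (there (∈-++⁺ʳ _ (here refl))) (here refl) (there (here refl))
pair-in-cluster m m′ _ B₂ =
  in-block (there (∈-++⁺ʳ _ (there (here refl)))) (here refl) (there (here refl))
pair-in-cluster m m′ _ B₃ =
  in-block (there (∈-++⁺ʳ _ (there (there (here refl))))) (here refl) (there (here refl))

pair-distinct : ∀ k m m′ P → let a , b = points k m m′ P in vx k a ≢ vx k b
pair-distinct k m m′ A₀ˡ = steps-distinct k ≤-refl (m≤m+n 1 3) (A₀ˡ-steps k)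
pair-distinct k m m′ A₀ʳ = steps-distinct k ≤-refl (m≤m+n 1 3) (A₀ʳ-steps k)
pair-distinct k m m′ Aₖ  = steps-distinct k ≤-refl (m≤m+n 1 3) (Aₖ-steps k)
pair-distinct k m m′ B₁  = steps-distinct k (s≤s z≤n) (m≤m+n 2 2) (B₁-steps k)
pair-distinct k m m′ B₂  = steps-distinct k (s≤s z≤n) (m≤m+n 2 2) (B₂-steps k m)
pair-distinct k m m′ B₃  = steps-distinct k (s≤s z≤n) (m≤m+n 2 2) (B₃-steps k m′)

members : ∀ {n} (X : Subset n) →
  ∃[ L ] length L ≡ ∣ X ∣ × All (_∈ₛ X) L × (∀ {z} → z ∈ₛ X → z ∈ L)
members [] = [] , refl , [] , λ ()
members (outside ∷ X) =
  let L , |L|≡|X| , L⊆X , X⊆L = members X in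
  List.map suc L , trans (length-map suc L) |L|≡|X| , All.map⁺ (All.map there L⊆X) ,
  λ { (there z∈X) → ∈-map⁺ suc (X⊆L z∈X) }
members (inside ∷ X) =
  let L , |L|≡|X| , L⊆X , X⊆L = members X in
  zero ∷ List.map suc L , cong suc (trans (length-map suc L) |L|≡|X|) ,
  here ∷ All.map⁺ (All.map there L⊆X) ,
  λ { here → here refl ; (there z∈X) → there (∈-map⁺ suc (X⊆L z∈X)) }

equidistant-at : ∀ {k a b} (z : Fin (ord k)) → Equidistant k (toℕ z) a b →
  dist (ord k) (vx k a) z ≡ dist (ord k) (vx k b) z
equidistant-at {k} {a} {b} z (equidistant same) =
  subst (λ v → dist (ord k) (vx k a) v ≡ dist (ord k) (vx k b) v) toℕ-mod same
  where
  toℕ-mod : vx k (toℕ z) ≡ z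
  toℕ-mod = toℕ-injective (trans (toℕ-fromℕ< _) (m<n⇒m%n≡m (toℕ<n z)))

lemma3p9 : (k : ℕ) → 1 ≤ k → (m m' : ℕ) → 1 ≤ m → m < m' → m' ≤ k →
    (S : Subset (ord k)) → IsCluster (ord k) S (clusterA k m m') →
    (X : Subset (ord k)) → (∀ x → x ∈ₛ X → 4 * m' + 1 < toℕ x) →
    Resolves (ord k) X (clusterA k m m') → 3 ≤ ∣ X ∣
lemma3p9 k 1≤k m m′ _ m<m′ m′≤k _ _ X allowed resolves = ≮⇒≥ λ |X|<3 →
  let L , |L|≡|X| , L⊆X , X⊆L = members X
      P , unresolved = common-pair (λ z → Unresolved k m m′ (toℕ z)) L
                         (subst (_≤ 2) (sym |L|≡|X|) (≤-pred |X|<3))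
                         (λ z∈L → classify 1≤k m<m′ m′≤k _ (allowed _ (All.lookup L⊆X z∈L)) (toℕ<n _))
      j , a∈ , b∈ = pair-in-cluster m m′ 1≤k P
  in resolves j _ _ a∈ b∈ (pair-distinct k m m′ P) (λ z z∈X → equidistant-at z (unresolved (X⊆L z∈X)))
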